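{- Let $a>b\ge0$ be integers with $(1+i)\nmid(a+bi)$, and let $M\subseteq\mathbb{Z}[i]$ be closed under multiplication by the units $\{\pm1,\pm i\}$. If $\mathscr{S}_{a+bi}\subseteq U=\bigcup_{q\in\mathbb{Z}[i]}(M+q(a+bi))$, then $M\twoheadrightarrow\mathbb{Z}[i]/(a+bi)$.
   Context: For $a+bi\neq0$, $\mathscr{S}_{a+bi}=\{x+yi\in\mathbb{Z}[i]: x,y\ge0,\ x+y<\max(|a|,|b|)\}$. For $M\subseteq\mathbb{Z}[i]$, $M\twoheadrightarrow\mathbb{Z}[i]/\beta$ means every residue class of $\mathbb{Z}[i]/(\beta)$ has a representative in $M$. -}

module Defs where

open import Data.Integer using (ℤ; +_; _+_; _*_; -_; _-_; ∣_∣; _≤_; _<_)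
open import Data.Nat using (ℕ; _⊔_)
open import Data.Sum using (_⊎_)
open import Data.Product using (Σ; _×_; _,_; ∃; ∃-syntax)
open import Relation.Binary.PropositionalEquality using (_≡_)

record ℤ[i] : Set where
  constructor _+_i
  field
    re : ℤ
    im : ℤ
open ℤ[i] public

infixl 6 _⊕_ _⊖_
infixl 7 _⊗_

_⊕_ : ℤ[i] → ℤ[i] → ℤ[i]
(a + b i) ⊕ (c + d i) = (a + c) + (b + d) i

_⊖_ : ℤ[i] → ℤ[i] → ℤ[i]
(a + b i) ⊖ (c + d i) = (a - c) + (b - d) i

_⊗_ : ℤ[i] → ℤ[i] → ℤ[i]
(a + b i) ⊗ (c + d i) = (a * c - b * d) + (a * d + b * c) i

0ᵍ 1ᵍ iᵍ : ℤ[i]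
0ᵍ = (+ 0) + (+ 0) i
1ᵍ = (+ 1) + (+ 0) i
iᵍ = (+ 0) + (+ 1) i

1+i : ℤ[i]
1+i = (+ 1) + (+ 1) i

_∣ᵍ_ : ℤ[i] → ℤ[i] → Set
β ∣ᵍ γ = ∃[ q ] γ ≡ q ⊗ β

-- The units of ℤ[i] are ±1, ±i; closure of M under multiplication by all of
-- them is equivalent to closure under multiplication by i (which generates the unit group),
-- but we state it literally for each unit.
Units : ℤ[i] → Set
Units u = (u ≡ 1ᵍ) ⊎ (u ≡ (- (+ 1)) + (+ 0) i) ⊎ (u ≡ iᵍ) ⊎ (u ≡ (+ 0) + (- (+ 1)) i)

UnitClosed : (ℤ[i] → Set) → Set
UnitClosed M = ∀ u z → Units u → M z → M (u ⊗ z)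

𝒮 : ℤ[i] → ℤ[i] → Set
𝒮 β z = (+ 0 ≤ re z) × (+ 0 ≤ im z) × (re z + im z < + (∣ re β ∣ ⊔ ∣ im β ∣))

UnionTranslates : (ℤ[i] → Set) → ℤ[i] → ℤ[i] → Set
UnionTranslates M β z = ∃[ m ] ∃[ q ] (M m × z ≡ m ⊕ q ⊗ β)

Surjects : (ℤ[i] → Set) → ℤ[i] → Set
Surjects M β = ∀ z → ∃[ m ] (M m × β ∣ᵍ (z ⊖ m))

-- Write ‖x + y i‖₁ = |x| + |y|. Every Gaussian integer is a unit times a point x + y i of the
-- closed first quadrant, and if x + y ≥ a then (x + y i) - (a + b i) or (x + y i) - i (a + b i)
-- has smaller norm, according to the sign of 2y - (a + b); this sign is never zero because
-- (1 + i) ∤ a + b i means that a + b is odd. Descending, every class modulo a + b i contains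
-- an element of norm < a = max(a, b), which is u s with u a unit and s ∈ 𝒮. By hypothesis
-- s ≡ m modulo a + b i for some m ∈ M, so the class contains u m ∈ M.

module Submission where

open import Defs
open import Data.Nat using (ℕ; suc; z≤n)
open import Data.Product using (_×_; _,_; ∃-syntax)
open import Data.Sum using (_⊎_; inj₁; inj₂)
open import Relation.Binary.PropositionalEquality

module NatDistance where
  open import Data.Nat using (_+_; _<_; _≤_; ∣_-_∣)
  open import Data.Nat.Properties
  import Data.Nat.Tactic.RingSolver as ℕ-Solver
  open import Algebra.Properties.CommutativeSemigroup +-commutativeSemigroup
    using (xy∙z≈xz∙y; x∙yz≈xz∙y; interchange)
  open import Relation.Nullary using (contradiction)
  open import Relation.Binary.Definitions using (tri<; tri≈; tri>)

  ∣m-n∣+n≡m : ∀ {m n} → n ≤ m → ∣ m - n ∣ + n ≡ m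
  ∣m-n∣+n≡m {m} {n} n≤m = trans (cong (_+ n) (m≤n⇒∣n-m∣≡n∸m n≤m)) (m∸n+n≡m n≤m)

  ∣m-n∣+m≡n : ∀ {m n} → m ≤ n → ∣ m - n ∣ + m ≡ n
  ∣m-n∣+m≡n {m} {n} m≤n = trans (cong (_+ m) (∣-∣-comm m n)) (∣m-n∣+n≡m m≤n)

  ∣y-a∣+b<y : ∀ {a b y} → b < a → a + b < y + y → ∣ y - a ∣ + b < y
  ∣y-a∣+b<y {a} {b} {y} b<a a+b<y+y with ≤-total a y
  ... | inj₁ a≤y = begin-strict
    ∣ y - a ∣ + b  <⟨ +-monoʳ-< ∣ y - a ∣ b<a ⟩
    ∣ y - a ∣ + a  ≡⟨ ∣m-n∣+n≡m a≤y ⟩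
    y              ∎
    where open ≤-Reasoning
  ... | inj₂ y≤a = +-cancelʳ-< y _ _ (begin-strict
    ∣ y - a ∣ + b + y  ≡⟨ xy∙z≈xz∙y ∣ y - a ∣ b y ⟩
    ∣ y - a ∣ + y + b  ≡⟨ cong (_+ b) (∣m-n∣+m≡n y≤a) ⟩
    a + b              <⟨ a+b<y+y ⟩
    y + y              ∎)
    where open ≤-Reasoning

  ∣x-a∣+∣y-b∣<x+y : ∀ {a b x y} → b < a → a ≤ x + y → y + y < a + b →
                    ∣ x - a ∣ + ∣ y - b ∣ < x + y
  ∣x-a∣+∣y-b∣<x+y {a} {b} {x} {y} b<a a≤x+y y+y<a+b with ≤-total a x | ≤-total b y
  ... | inj₁ a≤x | _ = +-cancelʳ-< a _ _ (begin-strict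
    ∣ x - a ∣ + ∣ y - b ∣ + a  ≡⟨ xy∙z≈xz∙y ∣ x - a ∣ ∣ y - b ∣ a ⟩
    ∣ x - a ∣ + a + ∣ y - b ∣  ≡⟨ cong (_+ ∣ y - b ∣) (∣m-n∣+n≡m a≤x) ⟩
    x + ∣ y - b ∣              ≤⟨ +-monoʳ-≤ x (≤-trans (∣m-n∣≤m⊔n y b) (m⊔n≤m+n y b)) ⟩
    x + (y + b)                <⟨ +-monoʳ-< x (+-monoʳ-< y b<a) ⟩
    x + (y + a)                ≡⟨ +-assoc x y a ⟨
    x + y + a                  ∎)
    where open ≤-Reasoning
  ... | inj₂ x≤a | inj₁ b≤y = +-cancelʳ-< (x + b) _ _ (begin-strict
    ∣ x - a ∣ + ∣ y - b ∣ + (x + b)  ≡⟨ interchange ∣ x - a ∣ ∣ y - b ∣ x b ⟩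
    ∣ x - a ∣ + x + (∣ y - b ∣ + b)  ≡⟨ cong₂ _+_ (∣m-n∣+m≡n x≤a) (∣m-n∣+n≡m b≤y) ⟩
    a + y                            <⟨ +-monoˡ-< y a<x+x+b ⟩
    x + x + b + y                    ≡⟨ rearrange x y b ⟩
    x + y + (x + b)                  ∎)
    where
    open ≤-Reasoning
    rearrange : ∀ x y b → x + x + b + y ≡ x + y + (x + b)
    rearrange = ℕ-Solver.solve-∀
    a<x+x+b : a < x + x + b
    a<x+x+b = +-cancelʳ-< a _ _ (begin-strict
      a + a            ≤⟨ +-mono-≤ a≤x+y a≤x+y ⟩
      x + y + (x + y)  ≡⟨ interchange x y x y ⟩
      x + x + (y + y)  <⟨ +-monoʳ-< (x + x) y+y<a+b ⟩
      x + x + (a + b)  ≡⟨ x∙yz≈xz∙y (x + x) a b ⟩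
      x + x + b + a    ∎)
  ... | inj₂ x≤a | inj₂ y≤b = +-cancelʳ-< (x + y) _ _ (begin-strict
    ∣ x - a ∣ + ∣ y - b ∣ + (x + y)  ≡⟨ interchange ∣ x - a ∣ ∣ y - b ∣ x y ⟩
    ∣ x - a ∣ + x + (∣ y - b ∣ + y)  ≡⟨ cong₂ _+_ (∣m-n∣+m≡n x≤a) (∣m-n∣+m≡n y≤b) ⟩
    a + b                            <⟨ +-monoʳ-< a b<a ⟩
    a + a                            ≤⟨ +-mono-≤ a≤x+y a≤x+y ⟩
    x + y + (x + y)                  ∎)
    where open ≤-Reasoning

  ∣x-a∣+∣y-b∣<x+y⊎x+b+∣y-a∣<x+y : ∀ {a b x y} → b < a → (∀ k → a + b ≢ k + k) → a ≤ x + y →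
                                   ∣ x - a ∣ + ∣ y - b ∣ < x + y ⊎ x + b + ∣ y - a ∣ < x + y
  ∣x-a∣+∣y-b∣<x+y⊎x+b+∣y-a∣<x+y {a} {b} {x} {y} b<a a+b-odd a≤x+y with <-cmp (y + y) (a + b)
  ... | tri< y+y<a+b _ _ = inj₁ (∣x-a∣+∣y-b∣<x+y {x = x} {y} b<a a≤x+y y+y<a+b)
  ... | tri≈ _ y+y≡a+b _ = contradiction (sym y+y≡a+b) (a+b-odd y)
  ... | tri> _ _ a+b<y+y = inj₂ (begin-strict
    x + b + ∣ y - a ∣    ≡⟨ +-assoc x b ∣ y - a ∣ ⟩
    x + (b + ∣ y - a ∣)  ≡⟨ cong (x +_) (+-comm b ∣ y - a ∣) ⟩
    x + (∣ y - a ∣ + b)  <⟨ +-monoʳ-< x (∣y-a∣+b<y {y = y} b<a a+b<y+y) ⟩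
    x + y                ∎)
    where open ≤-Reasoning

module GaussianIntegers where
  open import Data.Integer using (+_; -[1+_]; _+_; _-_; _*_; -_; ∣_∣; +≤+; +<+) renaming (_⊖_ to _⊖ₙ_)
  open import Data.Integer.Properties using (∣-i∣≡∣i∣; m-n≡m⊖n; ∣⊖∣-≤; ∣m⊖n∣≡∣n⊖m∣)
  open import Data.Integer.Tactic.RingSolver using (solve-∀)
  import Data.Nat as ℕ
  open import Data.Nat.Properties using (≤-total; +-comm; m≤n⇒∣m-n∣≡n∸m; m≤n⇒∣n-m∣≡n∸m)

  ‖_‖₁ : ℤ[i] → ℕ
  ‖ z ‖₁ = ∣ re z ∣ ℕ.+ ∣ im z ∣

  infix 4 _≡_[mod_]
  record _≡_[mod_] (z w β : ℤ[i]) : Set where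
    constructor via
    field
      quotient : ℤ[i]
      equation : z ≡ w ⊕ quotient ⊗ β

  ∣+m-+n∣≡∣m-n∣ : ∀ m n → ∣ + m - + n ∣ ≡ ℕ.∣ m - n ∣
  ∣+m-+n∣≡∣m-n∣ m n with ≤-total m n
  ... | inj₁ m≤n = begin
    ∣ + m - + n ∣  ≡⟨ cong ∣_∣ (m-n≡m⊖n m n) ⟩
    ∣ m ⊖ₙ n ∣     ≡⟨ ∣⊖∣-≤ m≤n ⟩
    n ℕ.∸ m        ≡⟨ m≤n⇒∣m-n∣≡n∸m m≤n ⟨
    ℕ.∣ m - n ∣    ∎
    where open ≡-Reasoning
  ... | inj₂ n≤m = begin
    ∣ + m - + n ∣  ≡⟨ cong ∣_∣ (m-n≡m⊖n m n) ⟩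
    ∣ m ⊖ₙ n ∣     ≡⟨ ∣m⊖n∣≡∣n⊖m∣ m n ⟩
    ∣ n ⊖ₙ m ∣     ≡⟨ ∣⊖∣-≤ n≤m ⟩
    m ℕ.∸ n        ≡⟨ m≤n⇒∣n-m∣≡n∸m n≤m ⟨
    ℕ.∣ m - n ∣    ∎
    where open ≡-Reasoning

  ≡-mod-refl : ∀ {β} z → z ≡ z [mod β ]
  ≡-mod-refl {a + b i} (x + y i) = via 0ᵍ (cong₂ _+_i (re-eq x a b) (im-eq y a b))
    where
    re-eq : ∀ x a b → x ≡ x + (+ 0 * a - + 0 * b)
    re-eq = solve-∀
    im-eq : ∀ y a b → y ≡ y + (+ 0 * b + + 0 * a)
    im-eq = solve-∀

  ≡-mod-trans : ∀ {β z w v} → z ≡ w [mod β ] → w ≡ v [mod β ] → z ≡ v [mod β ]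
  ≡-mod-trans {a + b i} {z} {w} {v₁ + v₂ i} (via (p₁ + p₂ i) z≡w+pβ) (via (q₁ + q₂ i) refl) =
    via ((q₁ + p₁) + (q₂ + p₂) i) (trans z≡w+pβ (cong₂ _+_i (re-eq v₁ q₁ q₂ p₁ p₂ a b) (im-eq v₂ q₁ q₂ p₁ p₂ a b)))
    where
    re-eq : ∀ v q₁ q₂ p₁ p₂ a b →
            v + (q₁ * a - q₂ * b) + (p₁ * a - p₂ * b) ≡ v + ((q₁ + p₁) * a - (q₂ + p₂) * b)
    re-eq = solve-∀
    im-eq : ∀ v q₁ q₂ p₁ p₂ a b →
            v + (q₁ * b + q₂ * a) + (p₁ * b + p₂ * a) ≡ v + ((q₁ + p₁) * b + (q₂ + p₂) * a)
    im-eq = solve-∀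

  ≡-mod-⊗ˡ : ∀ {β z w} u → z ≡ w [mod β ] → u ⊗ z ≡ u ⊗ w [mod β ]
  ≡-mod-⊗ˡ {a + b i} {w = w₁ + w₂ i} (u₁ + u₂ i) (via (q₁ + q₂ i) refl) =
    via ((u₁ + u₂ i) ⊗ (q₁ + q₂ i)) (cong₂ _+_i (re-eq u₁ u₂ w₁ w₂ q₁ q₂ a b) (im-eq u₁ u₂ w₁ w₂ q₁ q₂ a b))
    where
    re-eq : ∀ u₁ u₂ w₁ w₂ q₁ q₂ a b →
            u₁ * (w₁ + (q₁ * a - q₂ * b)) - u₂ * (w₂ + (q₁ * b + q₂ * a))
            ≡ u₁ * w₁ - u₂ * w₂ + ((u₁ * q₁ - u₂ * q₂) * a - (u₁ * q₂ + u₂ * q₁) * b)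
    re-eq = solve-∀
    im-eq : ∀ u₁ u₂ w₁ w₂ q₁ q₂ a b →
            u₁ * (w₂ + (q₁ * b + q₂ * a)) + u₂ * (w₁ + (q₁ * a - q₂ * b))
            ≡ u₁ * w₂ + u₂ * w₁ + ((u₁ * q₁ - u₂ * q₂) * b + (u₁ * q₂ + u₂ * q₁) * a)
    im-eq = solve-∀

  ≡-mod⇒∣ᵍ⊖ : ∀ {β z w} → z ≡ w [mod β ] → β ∣ᵍ (z ⊖ w)
  ≡-mod⇒∣ᵍ⊖ {a + b i} {w = w₁ + w₂ i} (via (q₁ + q₂ i) refl) =
    q₁ + q₂ i , cong₂ _+_i (re-eq w₁ q₁ q₂ a b) (im-eq w₂ q₁ q₂ a b)
    where
    re-eq : ∀ w q₁ q₂ a b → w + (q₁ * a - q₂ * b) - w ≡ q₁ * a - q₂ * b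
    re-eq = solve-∀
    im-eq : ∀ w q₁ q₂ a b → w + (q₁ * b + q₂ * a) - w ≡ q₁ * b + q₂ * a
    im-eq = solve-∀

  x+yi≡[x-a]+[y-b]i : ∀ x y a b → x + y i ≡ (x - a) + (y - b) i [mod a + b i ]
  x+yi≡[x-a]+[y-b]i x y a b = via 1ᵍ (cong₂ _+_i (re-eq x a b) (im-eq y a b))
    where
    re-eq : ∀ x a b → x ≡ x - a + (+ 1 * a - + 0 * b)
    re-eq = solve-∀
    im-eq : ∀ y a b → y ≡ y - b + (+ 1 * b + + 0 * a)
    im-eq = solve-∀

  x+yi≡[x+b]+[y-a]i : ∀ x y a b → x + y i ≡ (x + b) + (y - a) i [mod a + b i ]
  x+yi≡[x+b]+[y-a]i x y a b = via iᵍ (cong₂ _+_i (re-eq x a b) (im-eq y a b))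
    where
    re-eq : ∀ x a b → x ≡ x + b + (+ 0 * a - + 1 * b)
    re-eq = solve-∀
    im-eq : ∀ y a b → y ≡ y - a + (+ 0 * b + + 1 * a)
    im-eq = solve-∀

  1+i∣a+bi : ∀ a b k → b + a ≡ k + k → 1+i ∣ᵍ (a + b i)
  1+i∣a+bi a b k b+a≡k+k = k + (k - a) i , cong₂ _+_i (re-eq a k) (begin
    b                            ≡⟨ cancel-a a b ⟩
    b + a - a                    ≡⟨ cong (_- a) b+a≡k+k ⟩
    k + k - a                    ≡⟨ im-eq a k ⟩
    k * + 1 + (k - a) * + 1      ∎)
    where
    open ≡-Reasoning
    cancel-a : ∀ a b → b ≡ b + a - a
    cancel-a = solve-∀
    re-eq : ∀ a k → a ≡ k * + 1 - (k - a) * + 1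
    re-eq = solve-∀
    im-eq : ∀ a k → k + k - a ≡ k * + 1 + (k - a) * + 1
    im-eq = solve-∀

  -1ᵍ -iᵍ : ℤ[i]
  -1ᵍ = (- (+ 1)) + (+ 0) i
  -iᵍ = (+ 0) + (- (+ 1)) i

  1ᵍ⊗ : ∀ x y → 1ᵍ ⊗ (x + y i) ≡ x + y i
  1ᵍ⊗ x y = cong₂ _+_i (re-eq x y) (im-eq x y)
    where
    re-eq : ∀ x y → + 1 * x - + 0 * y ≡ x
    re-eq = solve-∀
    im-eq : ∀ x y → + 1 * y + + 0 * x ≡ y
    im-eq = solve-∀

  -1ᵍ⊗ : ∀ x y → -1ᵍ ⊗ (x + y i) ≡ (- x) + (- y) i
  -1ᵍ⊗ x y = cong₂ _+_i (re-eq x y) (im-eq x y)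
    where
    re-eq : ∀ x y → - + 1 * x - + 0 * y ≡ - x
    re-eq = solve-∀
    im-eq : ∀ x y → - + 1 * y + + 0 * x ≡ - y
    im-eq = solve-∀

  iᵍ⊗ : ∀ x y → iᵍ ⊗ (x + y i) ≡ (- y) + x i
  iᵍ⊗ x y = cong₂ _+_i (re-eq x y) (im-eq x y)
    where
    re-eq : ∀ x y → + 0 * x - + 1 * y ≡ - y
    re-eq = solve-∀
    im-eq : ∀ x y → + 0 * y + + 1 * x ≡ x
    im-eq = solve-∀

  -iᵍ⊗ : ∀ x y → -iᵍ ⊗ (x + y i) ≡ y + (- x) i
  -iᵍ⊗ x y = cong₂ _+_i (re-eq x y) (im-eq x y)
    where
    re-eq : ∀ x y → + 0 * x - - + 1 * y ≡ y
    re-eq = solve-∀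
    im-eq : ∀ x y → + 0 * y + - + 1 * x ≡ - x
    im-eq = solve-∀

  ‖unit⊗z‖₁≡‖z‖₁ : ∀ {u} z → Units u → ‖ u ⊗ z ‖₁ ≡ ‖ z ‖₁
  ‖unit⊗z‖₁≡‖z‖₁ (x + y i) (inj₁ refl) = cong ‖_‖₁ (1ᵍ⊗ x y)
  ‖unit⊗z‖₁≡‖z‖₁ (x + y i) (inj₂ (inj₁ refl)) =
    trans (cong ‖_‖₁ (-1ᵍ⊗ x y)) (cong₂ ℕ._+_ (∣-i∣≡∣i∣ x) (∣-i∣≡∣i∣ y))
  ‖unit⊗z‖₁≡‖z‖₁ (x + y i) (inj₂ (inj₂ (inj₁ refl))) =
    trans (cong ‖_‖₁ (iᵍ⊗ x y)) (trans (cong (ℕ._+ ∣ x ∣) (∣-i∣≡∣i∣ y)) (+-comm ∣ y ∣ ∣ x ∣))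
  ‖unit⊗z‖₁≡‖z‖₁ (x + y i) (inj₂ (inj₂ (inj₂ refl))) =
    trans (cong ‖_‖₁ (-iᵍ⊗ x y)) (trans (cong (∣ y ∣ ℕ.+_) (∣-i∣≡∣i∣ x)) (+-comm ∣ y ∣ ∣ x ∣))

  unit⊗first-quadrant : ∀ z → ∃[ u ] ∃[ x ] ∃[ y ] Units u × z ≡ u ⊗ ((+ x) + (+ y) i)
  unit⊗first-quadrant ((+ x) + (+ y) i) = 1ᵍ , x , y , inj₁ refl , sym (1ᵍ⊗ _ _)
  unit⊗first-quadrant (-[1+ x ] + (+ y) i) = iᵍ , y , suc x , inj₂ (inj₂ (inj₁ refl)) , sym (iᵍ⊗ _ _)
  unit⊗first-quadrant (-[1+ x ] + -[1+ y ] i) = -1ᵍ , suc x , suc y , inj₂ (inj₁ refl) , sym (-1ᵍ⊗ _ _)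
  unit⊗first-quadrant ((+ x) + -[1+ y ] i) = -iᵍ , suc y , x , inj₂ (inj₂ (inj₂ refl)) , sym (-iᵍ⊗ _ _)

  unit⊗𝒮-of-short : ∀ β w → ‖ w ‖₁ ℕ.< ∣ re β ∣ ℕ.⊔ ∣ im β ∣ →
                    ∃[ u ] ∃[ s ] Units u × 𝒮 β s × w ≡ u ⊗ s
  unit⊗𝒮-of-short β w short with unit⊗first-quadrant w
  ... | u , x , y , unit , refl =
    u , (+ x) + (+ y) i , unit ,
    (+≤+ z≤n , +≤+ z≤n , +<+ (subst (ℕ._< ∣ re β ∣ ℕ.⊔ ∣ im β ∣) (‖unit⊗z‖₁≡‖z‖₁ _ unit) short)) , refl

module Descent where
  open import Data.Nat using (_+_; _<_; _≤_; _≤?_)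
  open import Data.Nat.Properties using (≰⇒>; <-≤-trans; m≤m⊔n; +-comm)
  open import Data.Nat.Induction using (<-wellFounded)
  open import Induction.WellFounded using (Acc; acc)
  open import Data.Integer as ℤ using (+_)
  open import Relation.Nullary using (¬_; yes; no)
  open NatDistance
  open GaussianIntegers

  1+i∤⇒odd : ∀ {a b} → ¬ (1+i ∣ᵍ ((+ a) + (+ b) i)) → ∀ k → a + b ≢ k + k
  1+i∤⇒odd {a} {b} 1+i∤β k a+b≡k+k =
    1+i∤β (1+i∣a+bi (+ a) (+ b) (+ k) (cong +_ (trans (+-comm b a) a+b≡k+k)))

  module _ {a b} (b<a : b < a) (odd : ∀ k → a + b ≢ k + k) where

    private
      β : ℤ[i]
      β = (+ a) + (+ b) i

    shorter-in-first-quadrant : ∀ x y → a ≤ x + y →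
                                ∃[ z ] ‖ z ‖₁ < x + y × (+ x) + (+ y) i ≡ z [mod β ]
    shorter-in-first-quadrant x y a≤x+y
      with ∣x-a∣+∣y-b∣<x+y⊎x+b+∣y-a∣<x+y {x = x} {y} b<a odd a≤x+y
    ... | inj₁ shorter =
      (+ x ℤ.- + a) + (+ y ℤ.- + b) i ,
      subst₂ (λ m n → m + n < x + y) (sym (∣+m-+n∣≡∣m-n∣ x a)) (sym (∣+m-+n∣≡∣m-n∣ y b)) shorter ,
      x+yi≡[x-a]+[y-b]i (+ x) (+ y) (+ a) (+ b)
    ... | inj₂ shorter =
      (+ x ℤ.+ + b) + (+ y ℤ.- + a) i ,
      subst (λ n → x + b + n < x + y) (sym (∣+m-+n∣≡∣m-n∣ y a)) shorter ,
      x+yi≡[x+b]+[y-a]i (+ x) (+ y) (+ a) (+ b)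

    shorter-representative : ∀ z → a ≤ ‖ z ‖₁ → ∃[ z′ ] ‖ z′ ‖₁ < ‖ z ‖₁ × z ≡ z′ [mod β ]
    shorter-representative z a≤‖z‖ with unit⊗first-quadrant z
    ... | u , x , y , unit , refl
        with shorter-in-first-quadrant x y (subst (a ≤_) (‖unit⊗z‖₁≡‖z‖₁ _ unit) a≤‖z‖)
    ... | z′ , shorter , x+yi≡z′ =
      u ⊗ z′ ,
      subst₂ _<_ (sym (‖unit⊗z‖₁≡‖z‖₁ z′ unit)) (sym (‖unit⊗z‖₁≡‖z‖₁ _ unit)) shorter ,
      ≡-mod-⊗ˡ u x+yi≡z′

    short-representative : ∀ z → Acc _<_ ‖ z ‖₁ → ∃[ w ] ‖ w ‖₁ < a × z ≡ w [mod β ]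
    short-representative z (acc rec) with a ≤? ‖ z ‖₁
    ... | no a≰‖z‖ = z , ≰⇒> a≰‖z‖ , ≡-mod-refl z
    ... | yes a≤‖z‖ with shorter-representative z a≤‖z‖
    ... | z′ , shorter , z≡z′ with short-representative z′ (rec shorter)
    ... | w , short , z′≡w = w , short , ≡-mod-trans z≡z′ z′≡w

    unit⊗𝒮-representative : ∀ z → ∃[ u ] ∃[ s ] Units u × 𝒮 β s × z ≡ u ⊗ s [mod β ]
    unit⊗𝒮-representative z with short-representative z (<-wellFounded ‖ z ‖₁)
    ... | w , short , z≡w with unit⊗𝒮-of-short β w (<-≤-trans short (m≤m⊔n a b))
    ... | u , s , unit , s∈𝒮 , refl = u , s , unit , s∈𝒮 , z≡w

open import Data.Integer using (ℤ; +_; -[1+_]; _≤_; _<_; +<+)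
open import Relation.Nullary using (¬_)
open GaussianIntegers using (via; ≡-mod-trans; ≡-mod-⊗ˡ; ≡-mod⇒∣ᵍ⊖)
open Descent using (1+i∤⇒odd; unit⊗𝒮-representative)

lemma2p11 : (a b : ℤ) → b < a → + 0 ≤ b → ¬ (1+i ∣ᵍ (a + b i)) →
    (M : ℤ[i] → Set) → UnitClosed M →
    (∀ z → 𝒮 (a + b i) z → UnionTranslates M (a + b i) z) →
    Surjects M (a + b i)
lemma2p11 -[1+ _ ] (+ _) () _
lemma2p11 (+ a) (+ b) (+<+ b<a) _ 1+i∤β M closed 𝒮⊆U z
  with unit⊗𝒮-representative b<a (1+i∤⇒odd 1+i∤β) z
... | u , s , unit , s∈𝒮 , z≡us with 𝒮⊆U s s∈𝒮
... | m , q , m∈M , s≡m+qβ =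
  u ⊗ m , closed u m unit m∈M , ≡-mod⇒∣ᵍ⊖ (≡-mod-trans z≡us (≡-mod-⊗ˡ u (via q s≡m+qβ)))
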